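{- If $p$ is an odd prime, then $C(2p)=C(2(p+1))$.
   Context: Let $\phi$ be Euler's totient function and $g(n)=n-\phi(n)$ for $n\geq 1$ (the move map of the game \textsc{nontotient}); write $g^i$ for the $i$-fold iterate. For $n\geq 1$, $C(n)$ denotes the least $i\geq 0$ with $g^i(n)=1$. -}

module Defs where

open import Data.Nat using (ℕ; zero; suc; _∸_; _<_)
open import Data.Nat.GCD using (gcd)
open import Data.List using (List; length; filter)
open import Data.List.Base using (upTo)
open import Data.Nat.Coprimality using (Coprime; coprime?)
open import Relation.Binary.PropositionalEquality using (_≡_)

-- Euler's totient: φ n = #{ k ∈ {1,…,n} : gcd k n = 1 }  (φ 0 = 0, irrelevant here)
φ : ℕ → ℕ
φ n = length (filter (λ k → coprime? (suc k) n) (upTo n))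

g : ℕ → ℕ
g n = n ∸ φ n

iter : ℕ → ℕ → ℕ
iter zero    n = n
iter (suc i) n = g (iter i n)

-- IsC n i  :  i is the least i ≥ 0 with g^i(n) = 1, i.e. C(n) = i
IsC : ℕ → ℕ → Set
IsC n i = (iter i n ≡ 1) × (∀ j → j < i → ¬ (iter j n ≡ 1))
  where
  open import Data.Product using (_×_)
  open import Relation.Nullary using (¬_)

{-# OPTIONS --safe #-}
module Submission where

-- For odd p, φ(2p) = φ(p) = p − 1, so g(2p) = p + 1 and C(2p) = 1 + C(p + 1).  For even
-- m, j is prime to 2m iff it is prime to m, so φ(2m) = 2φ(m) and g(2m) = 2g(m); and for
-- even m ≥ 4, g(m) is again even because j ↦ m − j pairs off the units mod m.  Hence
-- doubling commutes with g along the orbit of an even number until it reaches 2, where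
-- g(4) = 2; so C(2m) = 1 + C(m) for every even m, in particular for m = p + 1.

open import Defs
open import Data.Nat using (ℕ; _*_; _+_)
open import Data.Nat.Primality using (Prime)
open import Data.Product using (Σ; _×_)
open import Relation.Binary.PropositionalEquality using (_≢_)

open import Algebra.Properties.CommutativeSemigroup using (interchange)
open import Data.Empty using (⊥-elim)
open import Data.List using (length; filter; applyUpTo)
open import Data.Nat using (zero; suc; nonTrivial⇒n>1; _∸_; _≤_; _<_; z≤n; s≤s; z<s; s<s)
open import Data.Nat.Coprimality using (Coprime; coprime?; coprime-divisor; 1-coprimeTo;
  0-coprimeTo-m⇒m≡1; prime⇒coprime) renaming (sym to coprime-sym)
open import Data.Nat.Divisibility
open import Data.Nat.Induction using (<-rec)
open import Data.Nat.Primality using (prime⇒irreducible; prime⇒nonTrivial)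
open import Data.Nat.Properties
open import Data.Nat.Tactic.RingSolver using (solve-∀)
open import Data.Product using (_,_; proj₁; proj₂; ∃-syntax)
open import Data.Sum using (_⊎_; inj₁; inj₂)
open import Function using (_∘_; _⇔_; mk⇔; Equivalence)
open import Level using (Level)
open import Relation.Binary.Definitions using (tri<; tri≈; tri>)
open import Relation.Binary.PropositionalEquality
open import Relation.Nullary using (Dec; yes; no; ¬_; contradiction)
open import Relation.Nullary.Decidable using (_×-dec_)
open import Relation.Unary using (Pred; Decidable)

private
  variable
    a ℓ : Level
    A : Set a
    P Q : Set ℓ
    j k m n : ℕ
    f h : ℕ → ℕ

∑< : ℕ → (ℕ → ℕ) → ℕ
∑< zero    f = 0
∑< (suc n) f = f 0 + ∑< n (f ∘ suc)

∑<-cong : ∀ n → (∀ {k} → k < n → f k ≡ h k) → ∑< n f ≡ ∑< n h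
∑<-cong zero    eq = refl
∑<-cong (suc n) eq = cong₂ _+_ (eq z<s) (∑<-cong n (eq ∘ s<s))

∑<-ones : ∀ n → ∑< n (λ _ → 1) ≡ n
∑<-ones zero    = refl
∑<-ones (suc n) = cong suc (∑<-ones n)

∑<-≤ : ∀ n → (∀ k → f k ≤ 1) → ∑< n f ≤ n
∑<-≤ zero    f≤1 = z≤n
∑<-≤ (suc n) f≤1 = +-mono-≤ (f≤1 0) (∑<-≤ n (f≤1 ∘ suc))

∑<-+ : ∀ m n f → ∑< (m + n) f ≡ ∑< m f + ∑< n (λ k → f (m + k))
∑<-+ zero    n f = refl
∑<-+ (suc m) n f = trans (cong (f 0 +_) (∑<-+ m n (f ∘ suc))) (sym (+-assoc (f 0) _ _))

∑<-suc : ∀ n f → ∑< (suc n) f ≡ ∑< n f + f n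
∑<-suc zero    f = +-identityʳ (f 0)
∑<-suc (suc n) f = trans (cong (f 0 +_) (∑<-suc n (f ∘ suc))) (sym (+-assoc (f 0) _ _))

∑<-distrib : ∀ n f h → ∑< n (λ k → f k + h k) ≡ ∑< n f + ∑< n h
∑<-distrib zero    f h = refl
∑<-distrib (suc n) f h = trans (cong (f 0 + h 0 +_) (∑<-distrib n (f ∘ suc) (h ∘ suc)))
  (interchange +-commutativeSemigroup (f 0) (h 0) _ _)

∑<-reflect : ∀ n → (∀ {i j} → suc (i + j) ≡ n → f i ≡ h j) → ∑< n f ≡ ∑< n h
∑<-reflect zero    _ = refl
∑<-reflect {f} {h} (suc n) mirror = begin
  f 0 + ∑< n (f ∘ suc)  ≡⟨ cong₂ _+_ (mirror refl) (∑<-reflect n (mirror ∘ cong suc)) ⟩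
  h n + ∑< n h          ≡⟨ +-comm (h n) _ ⟩
  ∑< n h + h n          ≡⟨ ∑<-suc n h ⟨
  ∑< (suc n) h          ∎
  where open ≡-Reasoning

∑<-rotate : ∀ n f → f 0 ≡ f n → ∑< n (f ∘ suc) ≡ ∑< n f
∑<-rotate n f f0≡fn = +-cancelʳ-≡ (f 0) _ _ (begin
  ∑< n (f ∘ suc) + f 0  ≡⟨ +-comm _ (f 0) ⟩
  ∑< (suc n) f          ≡⟨ ∑<-suc n f ⟩
  ∑< n f + f n          ≡⟨ cong (∑< n f +_) f0≡fn ⟨
  ∑< n f + f 0          ∎)
  where open ≡-Reasoning

𝟙 : Dec P → ℕ
𝟙 (yes _) = 1
𝟙 (no  _) = 0

𝟙≤1 : (p : Dec P) → 𝟙 p ≤ 1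
𝟙≤1 (yes _) = s≤s z≤n
𝟙≤1 (no  _) = z≤n

𝟙-yes : (p : Dec P) → P → 𝟙 p ≡ 1
𝟙-yes (yes _) _  = refl
𝟙-yes (no ¬p) p = ⊥-elim (¬p p)

𝟙-no : (p : Dec P) → ¬ P → 𝟙 p ≡ 0
𝟙-no (yes p) ¬p = ⊥-elim (¬p p)
𝟙-no (no _)  _  = refl

𝟙-⇔ : P ⇔ Q → (p : Dec P) (q : Dec Q) → 𝟙 p ≡ 𝟙 q
𝟙-⇔ P⇔Q p q with p | q
... | yes _ | yes _ = refl
... | no  _ | no  _ = refl
... | yes x | no ¬y = ⊥-elim (¬y (Equivalence.to P⇔Q x))
... | no ¬x | yes y = ⊥-elim (¬x (Equivalence.from P⇔Q y))

𝟙-×-dec : (p : Dec P) (q : Dec Q) → 𝟙 (p ×-dec q) ≡ 𝟙 p * 𝟙 q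
𝟙-×-dec (yes _) (yes _) = refl
𝟙-×-dec (yes _) (no  _) = refl
𝟙-×-dec (no  _) _       = refl

length-filter-applyUpTo : ∀ {P : Pred A ℓ} (P? : Decidable P) (f : ℕ → A) n →
  length (filter P? (applyUpTo f n)) ≡ ∑< n (λ k → 𝟙 (P? (f k)))
length-filter-applyUpTo P? f zero = refl
length-filter-applyUpTo P? f (suc n) with P? (f 0)
... | yes _ = cong suc (length-filter-applyUpTo P? (f ∘ suc) n)
... | no  _ = length-filter-applyUpTo P? (f ∘ suc) n

χ : ℕ → ℕ → ℕ
χ m j = 𝟙 (coprime? j m)

φ≡∑χ : ∀ n → φ n ≡ ∑< n (λ k → χ n (suc k))
φ≡∑χ n = length-filter-applyUpTo (λ k → coprime? (suc k) n) (λ k → k) n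

χ-cong : (∀ {d} → d ∣ m → d ∣ j → d ∣ k) → (∀ {d} → d ∣ m → d ∣ k → d ∣ j) →
         χ m j ≡ χ m k
χ-cong {m} {j} {k} j⇒k k⇒j = 𝟙-⇔
  (mk⇔ (λ c {d} (d∣k , d∣m) → c (k⇒j d∣m d∣k , d∣m))
       (λ c {d} (d∣j , d∣m) → c (j⇒k d∣m d∣j , d∣m)))
  (coprime? j m) (coprime? k m)

χ-+-multiple : ∀ {i} → m ∣ i → χ m (i + j) ≡ χ m j
χ-+-multiple m∣i = χ-cong (λ d∣m d∣i+j → ∣m+n∣m⇒∣n d∣i+j (∣-trans d∣m m∣i))
                          (λ d∣m d∣j → ∣m∣n⇒∣m+n (∣-trans d∣m m∣i) d∣j)

χ-complement : j + k ≡ m → χ m j ≡ χ m k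
χ-complement {j} {k} j+k≡m = χ-cong
  (λ d∣m d∣j → ∣m+n∣m⇒∣n (subst (_ ∣_) (sym j+k≡m) d∣m) d∣j)
  (λ d∣m d∣k → ∣m+n∣m⇒∣n (subst (_ ∣_) (sym (trans (+-comm k j) j+k≡m)) d∣m) d∣k)

coprime-*⇔ : ∀ {i} → Coprime j (i * m) ⇔ (Coprime j i × Coprime j m)
coprime-*⇔ {j} {m} {i} = mk⇔
  (λ c → (λ {d} (d∣j , d∣i) → c (d∣j , ∣m⇒∣m*n m d∣i))
        , (λ {d} (d∣j , d∣m) → c (d∣j , ∣n⇒∣m*n i d∣m)))
  (λ (ci , cm) {d} (d∣j , d∣im) →
    cm (d∣j , coprime-divisor (λ {e} (e∣d , e∣i) → ci (∣-trans e∣d d∣j , e∣i)) d∣im))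

χ-double : χ (2 * m) j ≡ χ 2 j * χ m j
χ-double {m} {j} =
  trans (𝟙-⇔ coprime-*⇔ (coprime? j (2 * m)) (coprime? j 2 ×-dec coprime? j m))
        (𝟙-×-dec (coprime? j 2) (coprime? j m))

χ-double-even : 2 ∣ m → χ (2 * m) j ≡ χ m j
χ-double-even {m} {j} 2∣m =
  𝟙-⇔ (mk⇔ (proj₂ ∘ Equivalence.to (coprime-*⇔ {i = 2})) coprime-double)
      (coprime? j (2 * m)) (coprime? j m)
  where
  coprime-double : Coprime j m → Coprime j (2 * m)
  coprime-double cm = Equivalence.from (coprime-*⇔ {i = 2})
    ((λ {d} (d∣j , d∣2) → cm (d∣j , ∣-trans d∣2 2∣m)) , cm)

χ2-alternates : ∀ j → χ 2 j + χ 2 (suc j) ≡ 1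
χ2-alternates zero    = refl
χ2-alternates (suc j) = trans (cong (χ 2 (suc j) +_) (χ-+-multiple {j = j} ∣-refl))
                              (trans (+-comm (χ 2 (suc j)) _) (χ2-alternates j))

χ2-odd-shift : ∀ r j → χ 2 j + χ 2 (suc (2 * r) + j) ≡ 1
χ2-odd-shift r j = begin
  χ 2 j + χ 2 (suc (2 * r) + j)  ≡⟨ cong (λ i → χ 2 j + χ 2 i) (+-suc (2 * r) j) ⟨
  χ 2 j + χ 2 (2 * r + suc j)    ≡⟨ cong (χ 2 j +_) (χ-+-multiple (m∣m*n r)) ⟩
  χ 2 j + χ 2 (suc j)            ≡⟨ χ2-alternates j ⟩
  1                              ∎
  where open ≡-Reasoning

χ-double-odd : ∀ r j → let o = suc (2 * r) in χ (2 * o) j + χ (2 * o) (o + j) ≡ χ o j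
χ-double-odd r j = begin
  χ (2 * o) j + χ (2 * o) (o + j)            ≡⟨ cong₂ _+_ χ-double (χ-double {j = o + j}) ⟩
  χ 2 j * χ o j + χ 2 (o + j) * χ o (o + j)  ≡⟨ cong (χ 2 j * χ o j +_)
                                                   (cong (χ 2 (o + j) *_) (χ-+-multiple ∣-refl)) ⟩
  χ 2 j * χ o j + χ 2 (o + j) * χ o j        ≡⟨ *-distribʳ-+ (χ o j) (χ 2 j) _ ⟨
  (χ 2 j + χ 2 (o + j)) * χ o j              ≡⟨ cong (_* χ o j) (χ2-odd-shift r j) ⟩
  1 * χ o j                                  ≡⟨ *-identityˡ (χ o j) ⟩
  χ o j                                      ∎
  where
  open ≡-Reasoning
  o = suc (2 * r)

2*n≢1 : ∀ n → 2 * n ≢ 1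
2*n≢1 n 2n≡1 = contradiction (∣1⇒≡1 (subst (2 ∣_) 2n≡1 (m∣m*n n))) λ ()

φ>0 : ∀ n → 0 < φ (suc n)
φ>0 n = subst (0 <_) (sym (φ≡∑χ (suc n)))
              (≤-trans (≤-reflexive (sym χ[1]≡1)) (m≤m+n _ _))
  where
  χ[1]≡1 : χ (suc n) 1 ≡ 1
  χ[1]≡1 = 𝟙-yes (coprime? 1 (suc n)) (1-coprimeTo (suc n))

φ[1+q]≡∑χ<q : ∀ q → 1 ≤ q → φ (suc q) ≡ ∑< q (λ k → χ (suc q) (suc k))
φ[1+q]≡∑χ<q q 1≤q = begin
  φ (suc q)                   ≡⟨ φ≡∑χ (suc q) ⟩
  ∑< (suc q) units            ≡⟨ ∑<-suc q units ⟩
  ∑< q units + units q        ≡⟨ cong (∑< q units +_) (𝟙-no (coprime? _ _) self-not-coprime) ⟩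
  ∑< q units + 0              ≡⟨ +-identityʳ _ ⟩
  ∑< q units                  ∎
  where
  open ≡-Reasoning
  units : ℕ → ℕ
  units k = χ (suc q) (suc k)
  self-not-coprime : ¬ Coprime (suc q) (suc q)
  self-not-coprime c = <⇒≢ (s≤s 1≤q) (sym (c (∣-refl , ∣-refl)))

φ<n : ∀ q → 1 ≤ q → φ (suc q) < suc q
φ<n q 1≤q = s≤s (subst (_≤ q) (sym (φ[1+q]≡∑χ<q q 1≤q))
                       (∑<-≤ q (λ k → 𝟙≤1 (coprime? (suc k) (suc q)))))

φ-prime : ∀ q → Prime (suc q) → φ (suc q) ≡ q
φ-prime q p-prime = begin
  φ (suc q)                        ≡⟨ φ[1+q]≡∑χ<q q 1≤q ⟩
  ∑< q (λ k → χ (suc q) (suc k))  ≡⟨ ∑<-cong q (λ k<q → 𝟙-yes _ (unit k<q)) ⟩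
  ∑< q (λ _ → 1)                   ≡⟨ ∑<-ones q ⟩
  q                                ∎
  where
  open ≡-Reasoning
  1≤q : 1 ≤ q
  1≤q = ≤-pred (nonTrivial⇒n>1 (suc q) {{prime⇒nonTrivial p-prime}})
  unit : ∀ {k} → k < q → Coprime (suc k) (suc q)
  unit k<q = coprime-sym (prime⇒coprime p-prime (s≤s k<q))

φ-double-∑ : ∀ m → φ (2 * m) ≡ ∑< m (λ k → χ (2 * m) (suc k) + χ (2 * m) (m + suc k))
φ-double-∑ m = begin
  φ (2 * m)
    ≡⟨ φ≡∑χ (2 * m) ⟩
  ∑< (2 * m) units
    ≡⟨ cong (λ n → ∑< n units) (cong (m +_) (+-identityʳ m)) ⟩
  ∑< (m + m) units
    ≡⟨ ∑<-+ m m units ⟩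
  ∑< m units + ∑< m (λ k → units (m + k))
    ≡⟨ cong (∑< m units +_) (∑<-cong m shift) ⟨
  ∑< m units + ∑< m (λ k → χ (2 * m) (m + suc k))
    ≡⟨ ∑<-distrib m units _ ⟨
  ∑< m (λ k → units k + χ (2 * m) (m + suc k))
    ∎
  where
  open ≡-Reasoning
  units : ℕ → ℕ
  units k = χ (2 * m) (suc k)
  shift : ∀ {k} → k < m → χ (2 * m) (m + suc k) ≡ units (m + k)
  shift {k} _ = cong (χ (2 * m)) (+-suc m k)

φ-double-odd : ∀ r → φ (2 * suc (2 * r)) ≡ φ (suc (2 * r))
φ-double-odd r = begin
  φ (2 * o)
    ≡⟨ φ-double-∑ o ⟩
  ∑< o (λ k → χ (2 * o) (suc k) + χ (2 * o) (o + suc k))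
    ≡⟨ ∑<-cong o (λ {k} _ → χ-double-odd r (suc k)) ⟩
  ∑< o (λ k → χ o (suc k))
    ≡⟨ φ≡∑χ o ⟨
  φ o
    ∎
  where
  open ≡-Reasoning
  o = suc (2 * r)

φ-double-even : 2 ∣ m → φ (2 * m) ≡ 2 * φ m
φ-double-even {m} 2∣m = begin
  φ (2 * m)
    ≡⟨ φ-double-∑ m ⟩
  ∑< m (λ k → χ (2 * m) (suc k) + χ (2 * m) (m + suc k))
    ≡⟨ ∑<-cong m (λ {k} _ → halves k) ⟩
  ∑< m (λ k → χ m (suc k) + χ m (suc k))
    ≡⟨ ∑<-distrib m _ _ ⟩
  ∑< m (λ k → χ m (suc k)) + ∑< m (λ k → χ m (suc k))
    ≡⟨ cong₂ _+_ (φ≡∑χ m) (φ≡∑χ m) ⟨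
  φ m + φ m
    ≡⟨ cong (φ m +_) (+-identityʳ (φ m)) ⟨
  2 * φ m
    ∎
  where
  open ≡-Reasoning
  halves : ∀ k → χ (2 * m) (suc k) + χ (2 * m) (m + suc k) ≡ χ m (suc k) + χ m (suc k)
  halves k = cong₂ _+_ (χ-double-even {j = suc k} 2∣m)
                       (trans (χ-double-even 2∣m) (χ-+-multiple ∣-refl))

φ-double-halves : ∀ n → 2 ≤ n → φ (2 * n) ≡ 2 * ∑< n (λ k → χ (2 * n) (suc k))
φ-double-halves n 2≤n = begin
  φ (2 * n)
    ≡⟨ φ-double-∑ n ⟩
  ∑< n (λ k → units (suc k) + units (n + suc k))
    ≡⟨ ∑<-distrib n _ _ ⟩
  ∑< n (units ∘ suc) + ∑< n (λ k → units (n + suc k))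
    ≡⟨ cong (∑< n (units ∘ suc) +_) upper≡lower ⟩
  ∑< n (units ∘ suc) + ∑< n (units ∘ suc)
    ≡⟨ cong (∑< n (units ∘ suc) +_) (+-identityʳ _) ⟨
  2 * ∑< n (units ∘ suc)
    ∎
  where
  open ≡-Reasoning
  units : ℕ → ℕ
  units = χ (2 * n)
  mirror : ∀ {i j} → suc (i + j) ≡ n → j + (n + suc i) ≡ 2 * n
  mirror {i} {j} i+j+1≡n =
    trans (reassoc i j n) (cong (n +_) (trans i+j+1≡n (sym (+-identityʳ n))))
    where
    reassoc : ∀ i j n → j + (n + suc i) ≡ n + suc (i + j)
    reassoc = solve-∀
  units[0]≡units[n] : units 0 ≡ units n
  units[0]≡units[n] = trans (𝟙-no (coprime? 0 (2 * n)) (2*n≢1 n ∘ 0-coprimeTo-m⇒m≡1))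
                            (sym (𝟙-no (coprime? n (2 * n)) n-not-coprime))
    where
    n-not-coprime : ¬ Coprime n (2 * n)
    n-not-coprime c = <⇒≢ 2≤n (sym (c (∣-refl , n∣m*n 2)))
  -- j ↦ 2n − j maps the upper half onto {0, …, n − 1}, which differs from the lower
  -- half {1, …, n} only in the terms 0 and n, both non-units.
  upper≡lower : ∑< n (λ k → units (n + suc k)) ≡ ∑< n (units ∘ suc)
  upper≡lower = trans (∑<-reflect n (λ {i} {j} e → sym (χ-complement (mirror {i} {j} e))))
                      (sym (∑<-rotate n units units[0]≡units[n]))

g-double-even : 2 ∣ m → g (2 * m) ≡ 2 * g m
g-double-even {m} 2∣m = begin
  2 * m ∸ φ (2 * m)  ≡⟨ cong (2 * m ∸_) (φ-double-even 2∣m) ⟩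
  2 * m ∸ 2 * φ m    ≡⟨ *-distribˡ-∸ 2 m (φ m) ⟨
  2 * g m            ∎
  where open ≡-Reasoning

g-double-even-valued : ∀ n → 2 ≤ n → ∃[ n′ ] g (2 * n) ≡ 2 * n′
g-double-even-valued n 2≤n = n ∸ half , (begin
  2 * n ∸ φ (2 * n)  ≡⟨ cong (2 * n ∸_) (φ-double-halves n 2≤n) ⟩
  2 * n ∸ 2 * half   ≡⟨ *-distribˡ-∸ 2 n half ⟨
  2 * (n ∸ half)     ∎)
  where
  open ≡-Reasoning
  half = ∑< n (λ k → χ (2 * n) (suc k))

g-double-odd-prime : ∀ r → Prime (suc (2 * r)) → g (2 * suc (2 * r)) ≡ 2 * suc r
g-double-odd-prime r p-prime = begin
  2 * p ∸ φ (2 * p)          ≡⟨ cong (2 * p ∸_) (φ-double-odd r) ⟩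
  2 * p ∸ φ p                ≡⟨ cong (2 * p ∸_) (φ-prime (2 * r) p-prime) ⟩
  2 * p ∸ 2 * r              ≡⟨ cong (_∸ 2 * r) (split r) ⟩
  2 * suc r + 2 * r ∸ 2 * r  ≡⟨ m+n∸n≡m (2 * suc r) (2 * r) ⟩
  2 * suc r                  ∎
  where
  open ≡-Reasoning
  p = suc (2 * r)
  split : ∀ r → 2 * suc (2 * r) ≡ 2 * suc r + 2 * r
  split = solve-∀

g<n : ∀ n → g (suc n) < suc n
g<n n = s≤s (∸-monoʳ-≤ (suc n) (φ>0 n))

g>0 : ∀ q → 1 ≤ q → 0 < g (suc q)
g>0 q 1≤q = m<n⇒0<n∸m (φ<n q 1≤q)

iter-suc : ∀ i n → iter (suc i) n ≡ iter i (g n)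
iter-suc zero    n = refl
iter-suc (suc i) n = cong g (iter-suc i n)

iter-0 : ∀ i → iter i 0 ≡ 0
iter-0 zero    = refl
iter-0 (suc i) = cong g (iter-0 i)

IsC-step : n ≢ 1 → IsC (g n) k → IsC n (suc k)
IsC-step {n} {k} n≢1 (reaches , least) = trans (iter-suc k n) reaches , earlier
  where
  earlier : ∀ j → j < suc k → iter j n ≢ 1
  earlier zero    _         = n≢1
  earlier (suc j) (s≤s j<k) = least j j<k ∘ trans (sym (iter-suc j n))

IsC-unstep : IsC n (suc k) → IsC (g n) k
IsC-unstep {n} {k} (reaches , least) =
  trans (sym (iter-suc k n)) reaches , λ j j<k → least (suc j) (s≤s j<k) ∘ trans (iter-suc j n)

IsC-unique : ∀ {i j} → IsC n i → IsC n j → i ≡ j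
IsC-unique {i = i} {j} (reachesᵢ , leastᵢ) (reachesⱼ , leastⱼ) with <-cmp i j
... | tri< i<j _ _ = contradiction reachesᵢ (leastⱼ i i<j)
... | tri≈ _ i≡j _ = i≡j
... | tri> _ _ j<i = contradiction reachesⱼ (leastᵢ j j<i)

IsC-exists : ∀ n → 1 ≤ n → ∃[ k ] IsC n k
IsC-exists = <-rec (λ n → 1 ≤ n → ∃[ k ] IsC n k) step
  where
  step : ∀ n → (∀ {m} → m < n → 1 ≤ m → ∃[ k ] IsC m k) → 1 ≤ n → ∃[ k ] IsC n k
  step (suc zero)    _   _ = 0 , refl , λ _ ()
  step (suc (suc q)) rec _ with rec (g<n (suc q)) (g>0 (suc q) (s≤s z≤n))
  ... | k , C[g[n]]≡k = suc k , IsC-step (λ ()) C[g[n]]≡k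

C[2]≡1 : IsC 2 1
C[2]≡1 = refl , λ { zero _ () ; (suc _) (s≤s ()) _ }

C[4]≡2 : IsC 4 2
C[4]≡2 = refl , λ { zero _ () ; (suc zero) _ () ; (suc (suc _)) (s≤s (s≤s ())) _ }

IsC-double : ∀ k n → IsC (2 * n) k → IsC (2 * (2 * n)) (suc k)
IsC-double k zero (reaches , _) = contradiction (trans (sym (iter-0 k)) reaches) λ ()
IsC-double k (suc zero) C[2]≡k with IsC-unique C[2]≡k C[2]≡1
... | refl = C[4]≡2
IsC-double zero          (suc (suc n)) (() , _)
IsC-double (suc k) n@(suc (suc _)) C[2n]≡1+k =
  IsC-step (2*n≢1 (2 * n)) (subst (λ x → IsC x (suc k)) g[4n]≡4n′ C[4n′]≡1+k)
  where
  n′ : ℕ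
  n′ = proj₁ (g-double-even-valued n (s≤s (s≤s z≤n)))
  g[2n]≡2n′ : g (2 * n) ≡ 2 * n′
  g[2n]≡2n′ = proj₂ (g-double-even-valued n (s≤s (s≤s z≤n)))
  C[4n′]≡1+k : IsC (2 * (2 * n′)) (suc k)
  C[4n′]≡1+k = IsC-double k n′ (subst (λ x → IsC x k) g[2n]≡2n′ (IsC-unstep C[2n]≡1+k))
  g[4n]≡4n′ : 2 * (2 * n′) ≡ g (2 * (2 * n))
  g[4n]≡4n′ = sym (trans (g-double-even (m∣m*n n)) (cong (2 *_) g[2n]≡2n′))

even-or-odd : ∀ n → (∃[ r ] n ≡ 2 * r) ⊎ (∃[ r ] n ≡ suc (2 * r))
even-or-odd zero = inj₁ (0 , refl)
even-or-odd (suc n) with even-or-odd n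
... | inj₁ (r , refl) = inj₂ (r , refl)
... | inj₂ (r , refl) = inj₁ (suc r , sym (*-suc 2 r))

odd-prime : ∀ {p} → Prime p → p ≢ 2 → ∃[ r ] p ≡ suc (2 * r)
odd-prime {p} p-prime p≢2 with even-or-odd p
... | inj₂ odd = odd
... | inj₁ (r , refl) with prime⇒irreducible p-prime (m∣m*n r)
...   | inj₁ ()
...   | inj₂ 2≡p = contradiction (sym 2≡p) p≢2

mainTheorem19 : (p : ℕ) → Prime p → p ≢ 2 →
    Σ ℕ (λ c → IsC (2 * p) c × IsC (2 * (p + 1)) c)
mainTheorem19 p p-prime p≢2 with odd-prime p-prime p≢2
... | r , refl with IsC-exists (2 * suc r) (s≤s z≤n)
...   | k , C[p+1]≡k = suc k , C[2p]≡1+k , C[2[p+1]]≡1+k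
  where
  p+1≡2[1+r] : suc (2 * r) + 1 ≡ 2 * suc r
  p+1≡2[1+r] = trans (+-comm _ 1) (sym (*-suc 2 r))
  C[2p]≡1+k : IsC (2 * p) (suc k)
  C[2p]≡1+k = IsC-step (2*n≢1 p)
    (subst (λ x → IsC x k) (sym (g-double-odd-prime r p-prime)) C[p+1]≡k)
  C[2[p+1]]≡1+k : IsC (2 * (p + 1)) (suc k)
  C[2[p+1]]≡1+k =
    subst (λ x → IsC (2 * x) (suc k)) (sym p+1≡2[1+r]) (IsC-double k (suc r) C[p+1]≡k)
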